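{- Let $p,q$ be positive integers. The componentwise map $(\sigma_1,\dots,\sigma_{p+q})\mapsto(|\sigma_1|,\dots,|\sigma_{p+q}|)$ is a bijection from $\mathcal{F}^{+}_{(p,q)}$ onto $\mathcal{F}_{(p,q)}$.
   Context: $B_n$ is the group of signed permutations of $\{\pm1,\dots,\pm n\}$ ($\sigma(-i)=-\sigma(i)$). Write $[a_1\dots a_k]=(a_1\dots a_k~-a_1\dots-a_k)$ and $((a_1\dots a_k))=(a_1\dots a_k)(-a_1\dots-a_k)$. Type $B$ transpositions are $[i]=(i~-i)$ and $((i~j))$ with $|i|\ne|j|$. For $\sigma\in B_n$, define $\sigma^+\in B_n$ by $\sigma^+(i)=|\sigma(i)|$ if $i>0$ and $\sigma^+(i)=-|\sigma(i)|$ if $i<0$, and $|\sigma|\in\mathcal{S}_n$ by $|\sigma|(i)=|\sigma(i)|$ for $1\le i\le n$. Let $\beta_{p,q}=((1~2\dots p))((p+1\dots p+q))\in B_{p+q}$. $\mathcal{F}^{+}_{(p,q)}$ is the set of $(p+q)$-tuples $(\sigma_1,\dots,\sigma_{p+q})$ of type $B$ transpositions in $B_{p+q}$ with $\sigma_1\cdots\sigma_{p+q}=\beta_{p,q}$, $\{|\sigma_1|,\dots,|\sigma_{p+q}|\}$ generating $\mathcal{S}_{p+q}$, and $\sigma_i=\sigma_i^+$ for all $i$. Let $\alpha_{p,q}=(1\dots p)(p+1\dots p+q)\in\mathcal{S}_{p+q}$; $\mathcal{F}_{(p,q)}$ is the set of $(p+q)$-tuples $(\eta_1,\dots,\eta_{p+q})$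 of transpositions of $\mathcal{S}_{p+q}$ with $\eta_1\cdots\eta_{p+q}=\alpha_{p,q}$ and $\{\eta_1,\dots,\eta_{p+q}\}$ generating $\mathcal{S}_{p+q}$. -}

module Defs where

open import Data.Bool using (Bool; true; false; not; if_then_else_)
open import Data.Nat using (ℕ; zero; suc; _+_; _<ᵇ_; _≡ᵇ_)
open import Data.Fin using (Fin; toℕ) renaming (zero to fzero; suc to fsuc)
import Data.Fin.Properties as FinP
import Data.Bool.Properties as BoolP
open import Data.Fin.Permutation using (Permutation′; permutation; transpose; _⟨$⟩ʳ_; _⟨$⟩ˡ_)
open import Data.Product using (Σ; ∃; ∃-syntax; _×_; _,_; proj₁; proj₂)
open import Data.Product.Properties using (≡-dec)
open import Data.Sum using (_⊎_)
open import Data.List using (List; []; _∷_)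
open import Function.Bundles using (_↔_; Inverse)
open import Relation.Nullary using (Dec; yes; no; ¬_)
open import Relation.Binary.PropositionalEquality
  using (_≡_; _≢_; refl; sym; trans; cong)

-- The set {±1,…,±n}: a sign (false = +, true = −) and an absolute value.

SInt : ℕ → Set
SInt n = Bool × Fin n

pos : ∀ {n} → Fin n → SInt n
pos i = (false , i)

neg : ∀ {n} → SInt n → SInt n
neg (s , i) = (not s , i)

_≟S_ : ∀ {n} (x y : SInt n) → Dec (x ≡ y)
_≟S_ = ≡-dec BoolP._≟_ FinP._≟_

record B (n : ℕ) : Set where
  field
    perm : SInt n ↔ SInt n
    odd  : ∀ x → Inverse.to perm (neg x) ≡ neg (Inverse.to perm x)

  app : SInt n → SInt n
  app = Inverse.to perm

open B public

_≈B_ : ∀ {n} → B n → B n → Set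
σ ≈B τ = ∀ x → app σ x ≡ app τ x

-- Product of a tuple of maps, σ₁ ⋯ σₖ = σ₁ ∘ ⋯ ∘ σₖ
-- (composition of functions; σₖ is applied first).
prodFun : ∀ {A : Set} {k} → (Fin k → (A → A)) → A → A
prodFun {k = zero}  fs x = x
prodFun {k = suc k} fs x = fs fzero (prodFun (λ i → fs (fsuc i)) x)

bracketFun : ∀ {n} → Fin n → SInt n → SInt n
bracketFun i (s , j) with FinP._≟_ j i
... | yes _ = (not s , j)
... | no  _ = (s , j)

-- ((a b)) = (a b)(-a -b), for signed a, b with |a| ≠ |b|
dblFun : ∀ {n} → SInt n → SInt n → SInt n → SInt n
dblFun a b x with x ≟S a
... | yes _ = b
... | no _ with x ≟S neg a
...   | yes _ = neg b
...   | no _ with x ≟S b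
...     | yes _ = a
...     | no _ with x ≟S neg b
...       | yes _ = neg a
...       | no _ = x

IsTranspB : ∀ {n} → B n → Set
IsTranspB {n} σ =
  (Σ (Fin n) λ i → ∀ x → app σ x ≡ bracketFun i x)
  ⊎ (Σ (SInt n) λ a → Σ (SInt n) λ b →
       proj₂ a ≢ proj₂ b × (∀ x → app σ x ≡ dblFun a b x))

plusFun : ∀ {n} → B n → SInt n → SInt n
plusFun σ (s , i) = (s , proj₂ (app σ (pos i)))

IsPlus : ∀ {n} → B n → Set
IsPlus σ = ∀ x → app σ x ≡ plusFun σ x

private
  negNeg : ∀ {n} (x : SInt n) → neg (neg x) ≡ x
  negNeg (s , i) = cong (_, i) (BoolP.not-involutive s)

  module _ {n} (σ : B n) where
    to = Inverse.to (perm σ)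
    from = Inverse.from (perm σ)

    from-odd : ∀ y → from (neg y) ≡ neg (from y)
    from-odd y =
      trans (cong (λ z → from (neg z)) (sym (Inverse.strictlyInverseˡ (perm σ) y)))
        (trans (cong from (sym (odd σ (from y))))
          (Inverse.strictlyInverseʳ (perm σ) (neg (from y))))

    to-abs : ∀ (x : SInt n) → proj₂ (to (pos (proj₂ x))) ≡ proj₂ (to x)
    to-abs (false , j) = refl
    to-abs (true , j) = cong proj₂ (odd σ (true , j))

    from-abs : ∀ (y : SInt n) → proj₂ (from (pos (proj₂ y))) ≡ proj₂ (from y)
    from-abs (false , j) = refl
    from-abs (true , j) = cong proj₂ (from-odd (true , j))

    absTo : Fin n → Fin n
    absTo i = proj₂ (to (pos i))

    absFrom : Fin n → Fin n
    absFrom i = proj₂ (from (pos i))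

    absInvˡ : ∀ i → absTo (absFrom i) ≡ i
    absInvˡ i = trans (to-abs (from (pos i)))
                  (cong proj₂ (Inverse.strictlyInverseˡ (perm σ) (pos i)))

    absInvʳ : ∀ i → absFrom (absTo i) ≡ i
    absInvʳ i = trans (from-abs (to (pos i)))
                  (cong proj₂ (Inverse.strictlyInverseʳ (perm σ) (pos i)))

absB : ∀ {n} → B n → Permutation′ n
absB σ = permutation (absTo σ) (absFrom σ) (absInvˡ σ) (absInvʳ σ)

IsTransp : ∀ {n} → Permutation′ n → Set
IsTransp {n} η = Σ (Fin n) λ i → Σ (Fin n) λ j →
  i ≢ j × (∀ x → η ⟨$⟩ʳ x ≡ transpose i j ⟨$⟩ʳ x)

-- The subgroup generated by gs₁,…,gsₖ is all of S_n: every permutation is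
-- a word in the generators and their inverses.
letter : ∀ {n k} → (Fin k → Permutation′ n) → Fin k × Bool → Fin n → Fin n
letter gs (j , false) = gs j ⟨$⟩ʳ_
letter gs (j , true)  = gs j ⟨$⟩ˡ_

wordFun : ∀ {n k} → (Fin k → Permutation′ n) → List (Fin k × Bool) → Fin n → Fin n
wordFun gs []       x = x
wordFun gs (l ∷ ws) x = letter gs l (wordFun gs ws x)

GeneratesSn : ∀ {n k} → (Fin k → Permutation′ n) → Set
GeneratesSn {n} {k} gs = ∀ (π : Permutation′ n) →
  ∃[ ws ] (∀ x → wordFun gs ws x ≡ π ⟨$⟩ʳ x)

-- α_{p,q} = (1 … p)(p+1 … p+q), on 0-based indices {0,…,p+q-1}:
-- 0→1→…→p-1→0 and p→p+1→…→p+q-1→p.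

alphaℕ : ℕ → ℕ → ℕ → ℕ
alphaℕ p q m =
  if m <ᵇ p
  then (if suc m ≡ᵇ p then 0 else suc m)
  else (if suc m ≡ᵇ p + q then p else suc m)

-- β_{p,q} = ((1 … p))((p+1 … p+q)) acts as α_{p,q} on absolute values and
-- preserves signs.
IsAlpha : ∀ p q → (Fin (p + q) → Fin (p + q)) → Set
IsAlpha p q f = ∀ x → toℕ (f x) ≡ alphaℕ p q (toℕ x)

IsBeta : ∀ p q → (SInt (p + q) → SInt (p + q)) → Set
IsBeta p q f = ∀ x → proj₁ (f x) ≡ proj₁ x × toℕ (proj₂ (f x)) ≡ alphaℕ p q (toℕ (proj₂ x))

InFplus : ∀ p q → (Fin (p + q) → B (p + q)) → Set
InFplus p q σ =
  (∀ i → IsTranspB (σ i))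
  × IsBeta p q (prodFun (λ i → app (σ i)))
  × GeneratesSn (λ i → absB (σ i))
  × (∀ i → IsPlus (σ i))

InF : ∀ p q → (Fin (p + q) → Permutation′ (p + q)) → Set
InF p q η =
  (∀ i → IsTransp (η i))
  × IsAlpha p q (prodFun (λ i → η i ⟨$⟩ʳ_))
  × GeneratesSn η

absTuple : ∀ {n k} → (Fin k → B n) → Fin k → Permutation′ n
absTuple σ i = absB (σ i)

_≈Tup_ : ∀ {n k} → (Fin k → B n) → (Fin k → B n) → Set
σ ≈Tup τ = ∀ i → σ i ≈B τ i

_≈TupS_ : ∀ {n k} → (Fin k → Permutation′ n) → (Fin k → Permutation′ n) → Set
η ≈TupS θ = ∀ i x → η i ⟨$⟩ʳ x ≡ θ i ⟨$⟩ʳ x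

module Submission where

-- The tuples in F⁺_{(p,q)} consist of sign-preserving elements σ = σ⁺,
-- i.e. maps of the form (s , m) ↦ (s , |σ| m).  Such an element is
-- determined by |σ|, and conversely every permutation η of Fin n has a
-- unique sign-preserving lift, with |lift η| = η on the nose.  The
-- theorem then follows from three facts about sign-preserving elements:
--   * a sign-preserving type B transposition is never a bracket [i], so it
--     is some ((a b)), and its absolute value is the transposition (|a| |b|);
--     conversely the lift of (i j) is the transposition ((i j));
--   * a product of sign-preserving maps is sign-preserving, with absolute
--     value the product of the absolute values, so β_{p,q} corresponds to
--     α_{p,q};
--   * generation of S_n only depends on the generators as functions.
-- So σ ↦ |σ| maps F⁺ into F (first component), is injective (second), and
-- the lift provides a preimage of every η ∈ F (third).

open import Defs
open import Data.Nat using (ℕ; zero; suc; _≤_; _+_)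
open import Data.Fin using (Fin; toℕ) renaming (zero to fzero; suc to fsuc)
open import Data.Fin.Permutation
  using (Permutation′; _⟨$⟩ʳ_; _⟨$⟩ˡ_; inverseˡ; inverseʳ)
import Data.Fin.Permutation.Components as PC
open import Data.Fin.Properties using (_≟_)
open import Data.Product using (Σ; _×_; _,_; proj₁; proj₂)
open import Data.Sum using (inj₁; inj₂)
open import Data.Bool using (Bool; true; false; not)
open import Data.List using (List; []; _∷_)
open import Function.Bundles using (mk↔ₛ′)
open import Data.Empty using (⊥-elim)
open import Relation.Nullary.Decidable using (yes; no; dec-true; dec-false)
open import Relation.Binary.PropositionalEquality

transpose-matchˡ : ∀ {n} (i j : Fin n) → PC.transpose i j i ≡ j
transpose-matchˡ i j rewrite dec-true (i ≟ i) refl = refl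

transpose-matchʳ : ∀ {n} (i j : Fin n) → j ≢ i → PC.transpose i j j ≡ i
transpose-matchʳ i j j≢i rewrite dec-false (j ≟ i) j≢i | dec-true (j ≟ j) refl = refl

transpose-mismatch : ∀ {n} (i j k : Fin n) → k ≢ i → k ≢ j → PC.transpose i j k ≡ k
transpose-mismatch i j k k≢i k≢j rewrite dec-false (k ≟ i) k≢i | dec-false (k ≟ j) k≢j = refl

abs-≢ : ∀ {n} (s t : Bool) (k m : Fin n) →
  (s , k) ≢ (t , m) → (s , k) ≢ (not t , m) → k ≢ m
abs-≢ false false k .k ≢t ≢¬t refl = ≢t refl
abs-≢ false true  k .k ≢t ≢¬t refl = ≢¬t refl
abs-≢ true  false k .k ≢t ≢¬t refl = ≢¬t refl
abs-≢ true  true  k .k ≢t ≢¬t refl = ≢t refl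

dblFun-abs : ∀ {n} (a b x : SInt n) →
  proj₂ (dblFun a b x) ≡ PC.transpose (proj₂ a) (proj₂ b) (proj₂ x)
dblFun-abs (t , i) (u , j) (s , k) with (s , k) ≟S (t , i)
... | yes refl = sym (transpose-matchˡ i j)
... | no ≢a with (s , k) ≟S (not t , i)
...   | yes refl = sym (transpose-matchˡ i j)
...   | no ≢¬a with (s , k) ≟S (u , j)
...     | yes refl = sym (transpose-matchʳ i j (abs-≢ s t j i ≢a ≢¬a))
...     | no ≢b with (s , k) ≟S (not u , j)
...       | yes refl = sym (transpose-matchʳ i j (abs-≢ s t j i ≢a ≢¬a))
...       | no ≢¬b = sym (transpose-mismatch i j k (abs-≢ s t k i ≢a ≢¬a) (abs-≢ s u k j ≢b ≢¬b))

dblFun-sign : ∀ {n} (i j : Fin n) (x : SInt n) →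
  proj₁ (dblFun (pos i) (pos j) x) ≡ proj₁ x
dblFun-sign i j (s , k) with (s , k) ≟S pos i
... | yes refl = refl
... | no _ with (s , k) ≟S neg (pos i)
...   | yes refl = refl
...   | no _ with (s , k) ≟S pos j
...     | yes refl = refl
...     | no _ with (s , k) ≟S neg (pos j)
...       | yes refl = refl
...       | no _ = refl

bracketFun-self : ∀ {n} (i : Fin n) (s : Bool) → bracketFun i (s , i) ≡ (not s , i)
bracketFun-self i s with i ≟ i
... | yes _   = refl
... | no i≢i = ⊥-elim (i≢i refl)

SignPreserving : ∀ {n} → (SInt n → SInt n) → (Fin n → Fin n) → Set
SignPreserving f g = ∀ s m → f (s , m) ≡ (s , g m)

plus-signPreserving : ∀ {n} (σ : B n) → IsPlus σ → SignPreserving (app σ) (absB σ ⟨$⟩ʳ_)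
plus-signPreserving σ plus s m = plus (s , m)

prod-signPreserving : ∀ {n k} (fs : Fin k → SInt n → SInt n) (gs : Fin k → Fin n → Fin n) →
  (∀ i → SignPreserving (fs i) (gs i)) → SignPreserving (prodFun fs) (prodFun gs)
prod-signPreserving {k = zero}  fs gs sp s m = refl
prod-signPreserving {k = suc k} fs gs sp s m = begin
  fs fzero (prodFun (λ i → fs (fsuc i)) (s , m))
    ≡⟨ cong (fs fzero) (prod-signPreserving _ _ (λ i → sp (fsuc i)) s m) ⟩
  fs fzero (s , prodFun (λ i → gs (fsuc i)) m)
    ≡⟨ sp fzero s _ ⟩
  (s , prodFun gs m) ∎
  where open ≡-Reasoning

beta⇒alpha : ∀ p q (f : SInt (p + q) → SInt (p + q)) (g : Fin (p + q) → Fin (p + q)) →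
  SignPreserving f g → IsBeta p q f → IsAlpha p q g
beta⇒alpha p q f g sp beta x =
  trans (cong (λ y → toℕ (proj₂ y)) (sym (sp false x))) (proj₂ (beta (pos x)))

alpha⇒beta : ∀ p q (f : SInt (p + q) → SInt (p + q)) (g : Fin (p + q) → Fin (p + q)) →
  SignPreserving f g → IsAlpha p q g → IsBeta p q f
alpha⇒beta p q f g sp alpha (s , m) =
  cong proj₁ (sp s m) , trans (cong (λ y → toℕ (proj₂ y)) (sp s m)) (alpha m)

plus-determined : ∀ {n} (σ τ : B n) → IsPlus σ → IsPlus τ →
  (∀ m → absB σ ⟨$⟩ʳ m ≡ absB τ ⟨$⟩ʳ m) → σ ≈B τ
plus-determined σ τ plusσ plusτ same (s , m) = begin
  app σ (s , m)         ≡⟨ plusσ (s , m) ⟩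
  (s , absB σ ⟨$⟩ʳ m)   ≡⟨ cong (s ,_) (same m) ⟩
  (s , absB τ ⟨$⟩ʳ m)   ≡⟨ sym (plusτ (s , m)) ⟩
  app τ (s , m)         ∎
  where open ≡-Reasoning

-- A sign-preserving type B transposition has a transposition as absolute
-- value: it cannot be a bracket [k], which flips the sign of k.
plus-transp : ∀ {n} (σ : B n) → IsPlus σ → IsTranspB σ → IsTransp (absB σ)
plus-transp σ plus (inj₁ (k , h)) with trans (sym (plus (pos k))) (trans (h (pos k)) (bracketFun-self k false))
... | ()
plus-transp σ plus (inj₂ (a , b , a≢b , h)) =
  proj₂ a , proj₂ b , a≢b , λ x → trans (cong proj₂ (h (pos x))) (dblFun-abs a b (pos x))

lift : ∀ {n} → Permutation′ n → B n
lift η = record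
  { perm = mk↔ₛ′ (λ x → (proj₁ x , η ⟨$⟩ʳ proj₂ x)) (λ x → (proj₁ x , η ⟨$⟩ˡ proj₂ x))
             (λ x → cong (proj₁ x ,_) (inverseʳ η)) (λ x → cong (proj₁ x ,_) (inverseˡ η))
  ; odd = λ x → refl }

lift-signPreserving : ∀ {n} (η : Permutation′ n) → SignPreserving (app (lift η)) (η ⟨$⟩ʳ_)
lift-signPreserving η s m = refl

lift-transp : ∀ {n} (η : Permutation′ n) → IsTransp η → IsTranspB (lift η)
lift-transp η (i , j , i≢j , h) = inj₂ (pos i , pos j , i≢j , λ x →
  trans (cong (proj₁ x ,_) (h (proj₂ x)))
    (sym (cong₂ _,_ (dblFun-sign i j x) (dblFun-abs (pos i) (pos j) x))))

wordFun-cong : ∀ {n k} (gs hs : Fin k → Permutation′ n) →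
  (∀ i x → gs i ⟨$⟩ʳ x ≡ hs i ⟨$⟩ʳ x) → (∀ i x → gs i ⟨$⟩ˡ x ≡ hs i ⟨$⟩ˡ x) →
  ∀ ws x → wordFun gs ws x ≡ wordFun hs ws x
wordFun-cong gs hs r l [] x = refl
wordFun-cong gs hs r l ((j , false) ∷ ws) x =
  trans (cong (gs j ⟨$⟩ʳ_) (wordFun-cong gs hs r l ws x)) (r j _)
wordFun-cong gs hs r l ((j , true) ∷ ws) x =
  trans (cong (gs j ⟨$⟩ˡ_) (wordFun-cong gs hs r l ws x)) (l j _)

generatesSn-cong : ∀ {n k} (gs hs : Fin k → Permutation′ n) →
  (∀ i x → gs i ⟨$⟩ʳ x ≡ hs i ⟨$⟩ʳ x) → (∀ i x → gs i ⟨$⟩ˡ x ≡ hs i ⟨$⟩ˡ x) →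
  GeneratesSn hs → GeneratesSn gs
generatesSn-cong gs hs r l gen π with gen π
... | ws , h = ws , λ x → trans (wordFun-cong gs hs r l ws x) (h x)

lemma3p6 : ∀ (p q : ℕ) → 1 ≤ p → 1 ≤ q →
    ((σ : Fin (p + q) → B (p + q)) → InFplus p q σ → InF p q (absTuple σ))
    × ((σ τ : Fin (p + q) → B (p + q)) → InFplus p q σ → InFplus p q τ →
    absTuple σ ≈TupS absTuple τ → σ ≈Tup τ)
    × ((η : Fin (p + q) → Permutation′ (p + q)) → InF p q η →
    Σ (Fin (p + q) → B (p + q)) (λ σ → InFplus p q σ × (absTuple σ ≈TupS η)))
lemma3p6 p q _ _ = maps-into , injective , surjective
  where
  maps-into : (σ : Fin (p + q) → B (p + q)) → InFplus p q σ → InF p q (absTuple σ)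
  maps-into σ (transp , beta , gen , plus) =
    (λ i → plus-transp (σ i) (plus i) (transp i)) ,
    beta⇒alpha p q _ _ (prod-signPreserving _ _ (λ i → plus-signPreserving (σ i) (plus i))) beta ,
    gen

  injective : (σ τ : Fin (p + q) → B (p + q)) → InFplus p q σ → InFplus p q τ →
    absTuple σ ≈TupS absTuple τ → σ ≈Tup τ
  injective σ τ (_ , _ , _ , plusσ) (_ , _ , _ , plusτ) same i =
    plus-determined (σ i) (τ i) (plusσ i) (plusτ i) (same i)

  surjective : (η : Fin (p + q) → Permutation′ (p + q)) → InF p q η →
    Σ (Fin (p + q) → B (p + q)) (λ σ → InFplus p q σ × (absTuple σ ≈TupS η))
  surjective η (transp , alpha , gen) =
    (λ i → lift (η i)) ,
    ((λ i → lift-transp (η i) (transp i)) ,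
     alpha⇒beta p q _ _ (prod-signPreserving _ _ (λ i → lift-signPreserving (η i))) alpha ,
     generatesSn-cong _ η (λ i x → refl) (λ i x → refl) gen ,
     (λ i x → refl)) ,
    (λ i x → refl)
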